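{- $\mathcal{U}(100) = \{1, 2, 3, 4, 5, 7, 8, 9, 10, 11, 13, 14, 16, 17, 19, 22, 23, 25, 26, 27, 29, 31, 32, 34, 37, 38, 39, 41, 43, 46, 47, 49, 50, 51, 53, 57, 58, 59, 61, 62, 64, 67, 69, 71, 73, 74, 79, 81, 82, 83, 86, 87, 89, 92, 93, 94, 97, 98\}$.
   Context: $\mathcal{U}$ is the set of positive integers $N$ such that $\sum_{n=1}^{N-1} w_n/n \ne 1/N$ for all choices $w_1,\dots,w_{N-1}\in\{ -1,0,+1\}$, and $\mathcal{U}(x) := \mathcal{U}\cap[1,x]$. -}

module Defs where

open import Data.Nat using (ℕ; zero; suc)
open import Data.Integer using (ℤ; +_; -[1+_])
open import Data.Rational using (ℚ; 0ℚ; _+_; _/_)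
open import Data.Fin using (Fin; inject₁; fromℕ)
open import Data.Empty using (⊥)
open import Relation.Binary.PropositionalEquality using (_≢_)

data Weight : Set where
  minus zero′ plus : Weight

wval : Weight → ℤ
wval minus = -[1+ 0 ]
wval zero′ = + 0
wval plus  = + 1

-- wsum m w = Σ_{n=1}^{m} w_n / n, where w_n = w (n-1) for the index in Fin m
wsum : (m : ℕ) → (Fin m → Weight) → ℚ
wsum zero    w = 0ℚ
wsum (suc m) w = wsum m (λ i → w (inject₁ i)) + (wval (w (fromℕ m)) / suc m)

InU : ℕ → Set
InU zero    = ⊥
InU (suc m) = (w : Fin m → Weight) → wsum m w ≢ (+ 1 / suc m)

module Submission where

-- Clearing denominators with L = lcm(1, …, N) turns Σ w_n/n = 1/N into Σ w_n (L/n) = L/N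
-- in ℤ.  For N ∉ 𝒰 an explicit choice of weights satisfies this identity.  For N ∈ 𝒰 take
-- a prime p such that N is divisible by p^k, the largest power of p not exceeding N.  Then
-- p^k exactly divides L, so p ∣ L/n unless p^k ∣ n: only the few multiples of p^k below N
-- contribute modulo p, and none of the residues they can produce is L/N mod p.
-- Both kinds of certificate are checked by evaluation.

open import Defs
open import Data.Empty using (⊥-elim)
open import Data.Fin using (Fin; toℕ; fromℕ; inject₁; fromℕ<)
open import Data.Fin.Properties using (all?; toℕ-fromℕ<)
open import Data.Integer as ℤ using (ℤ; +_; 0ℤ; 1ℤ)
import Data.Integer.Properties as ℤP
open import Data.Integer.Tactic.RingSolver using (solve-∀)
open import Data.List using (List; []; _∷_; map; concatMap)
open import Data.List.Membership.Propositional using (_∈_; _∉_)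
open import Data.List.Membership.Propositional.Properties using (∈-map⁺; ∈-concatMap⁺)
open import Data.List.Relation.Unary.Any as Any using (here; there)
open import Data.Nat using (ℕ; zero; suc; _+_; _*_; _<_; _≤_; s≤s; NonZero; ≢-nonZero; ≢-nonZero⁻¹)
open import Data.Nat.Divisibility using (_∣_; ∣-trans)
open import Data.Nat.DivMod using (_/_; _%_; %-distribˡ-+; %-distribˡ-*; m%n%n≡m%n; m/n*n≡m)
open import Data.Nat.GCD using (gcd)
open import Data.Nat.LCM using (lcm; m∣lcm[m,n]; n∣lcm[m,n]; gcd*lcm)
import Data.Nat.Properties as ℕP
open import Data.List.Membership.DecPropositional ℕP._≟_ using (_∈?_)
open import Data.Product using (_×_; _,_)
open import Data.Rational as ℚ using (toℚᵘ)
import Data.Rational.Properties as ℚP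
open import Data.Rational.Unnormalised as ℚᵘ using (*≡*) renaming (_≃_ to _≃ᵘ_)
import Data.Rational.Unnormalised.Properties as ℚᵘP
open import Data.Sum using (inj₁; inj₂)
open import Data.Vec using (Vec; lookup; _∷_; [])
open import Function using (_∘_; const)
open import Function.Bundles using (_⇔_; mk⇔; Equivalence)
open import Relation.Binary.PropositionalEquality using (_≡_; _≢_; refl; sym; trans; cong; cong₂; subst; module ≡-Reasoning)
open import Relation.Nullary using (Dec; yes; no; ¬?; _×-dec_; toWitness; toWitnessFalse)

digit : Weight → ℕ
digit minus = 0
digit zero′ = 1
digit plus  = 2

digits : List ℕ
digits = 0 ∷ 1 ∷ 2 ∷ []

digit∈digits : ∀ x → digit x ∈ digits
digit∈digits minus = here refl
digit∈digits zero′ = there (here refl)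
digit∈digits plus  = there (there (here refl))

wval+1≡digit : ∀ x → wval x ℤ.+ 1ℤ ≡ + digit x
wval+1≡digit minus = refl
wval+1≡digit zero′ = refl
wval+1≡digit plus  = refl

module _ (c : ℕ → ℕ) where

  open ≡-Reasoning

  combination : (m : ℕ) → (Fin m → Weight) → ℤ
  combination zero    w = 0ℤ
  combination (suc m) w = combination m (w ∘ inject₁) ℤ.+ wval (w (fromℕ m)) ℤ.* + c m

  digitCombination : (m : ℕ) → (Fin m → Weight) → ℕ
  digitCombination zero    w = 0
  digitCombination (suc m) w = digitCombination m (w ∘ inject₁) + digit (w (fromℕ m)) * c m

  coefficientSum : ℕ → ℕ
  coefficientSum zero    = 0
  coefficientSum (suc m) = coefficientSum m + c m

  digitCombination≡combination+coefficientSum : ∀ m w →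
    + digitCombination m w ≡ combination m w ℤ.+ + coefficientSum m
  digitCombination≡combination+coefficientSum zero    w = refl
  digitCombination≡combination+coefficientSum (suc m) w = begin
    + (D + digit x * c m)                        ≡⟨ ℤP.pos-+ D (digit x * c m) ⟩
    + D ℤ.+ + (digit x * c m)                    ≡⟨ cong₂ ℤ._+_ IH (ℤP.pos-* (digit x) (c m)) ⟩
    (T ℤ.+ + S) ℤ.+ + digit x ℤ.* + c m          ≡⟨ cong (λ d → (T ℤ.+ + S) ℤ.+ d ℤ.* + c m) (wval+1≡digit x) ⟨
    (T ℤ.+ + S) ℤ.+ (wval x ℤ.+ 1ℤ) ℤ.* + c m    ≡⟨ regroup T (+ S) (wval x) (+ c m) ⟩
    (T ℤ.+ wval x ℤ.* + c m) ℤ.+ (+ S ℤ.+ + c m) ≡⟨ cong (ℤ._+_ (T ℤ.+ wval x ℤ.* + c m)) (ℤP.pos-+ S (c m)) ⟨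
    (T ℤ.+ wval x ℤ.* + c m) ℤ.+ + (S + c m)     ∎
    where
    x : Weight
    x = w (fromℕ m)
    D S : ℕ
    D = digitCombination m (w ∘ inject₁)
    S = coefficientSum m
    T : ℤ
    T = combination m (w ∘ inject₁)
    IH : + D ≡ T ℤ.+ + S
    IH = digitCombination≡combination+coefficientSum m (w ∘ inject₁)
    regroup : ∀ t s v k → (t ℤ.+ s) ℤ.+ (v ℤ.+ 1ℤ) ℤ.* k ≡ (t ℤ.+ v ℤ.* k) ℤ.+ (s ℤ.+ k)
    regroup = solve-∀

module _ (p : ℕ) .{{_ : NonZero p}} where

  open ≡-Reasoning

  -- A coefficient divisible by p leaves every residue unchanged; skipping it keeps the
  -- list from tripling, which is what makes the enumeration feasible.
  extend : ℕ → List ℕ → List ℕ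
  extend zero      rs = rs
  extend c@(suc _) rs = concatMap (λ r → map (λ d → (r + d * c) % p) digits) rs

  residues : (ℕ → ℕ) → ℕ → List ℕ
  residues c zero    = 0 % p ∷ []
  residues c (suc m) = extend (c m % p) (residues c m)

  [s+d*c]%p≡[s%p+d*[c%p]]%p : ∀ s d c → (s + d * c) % p ≡ (s % p + d * (c % p)) % p
  [s+d*c]%p≡[s%p+d*[c%p]]%p s d c = begin
    (s + d * c) % p                   ≡⟨ %-distribˡ-+ s (d * c) p ⟩
    (s % p + d * c % p) % p           ≡⟨ cong₂ (λ a b → (a + b) % p) (sym (m%n%n≡m%n s p)) d*c%p≡d*[c%p]%p ⟩
    (s % p % p + d * (c % p) % p) % p ≡⟨ %-distribˡ-+ (s % p) (d * (c % p)) p ⟨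
    (s % p + d * (c % p)) % p         ∎
    where
    d*c%p≡d*[c%p]%p : d * c % p ≡ d * (c % p) % p
    d*c%p≡d*[c%p]%p = begin
      d * c % p                   ≡⟨ %-distribˡ-* d c p ⟩
      (d % p) * (c % p) % p       ≡⟨ cong (λ e → (d % p) * e % p) (m%n%n≡m%n c p) ⟨
      (d % p) * (c % p % p) % p   ≡⟨ %-distribˡ-* d (c % p) p ⟨
      d * (c % p) % p             ∎

  ∈-extend : ∀ s d c {rs} → d ∈ digits → s % p ∈ rs → (s + d * c) % p ∈ extend (c % p) rs
  ∈-extend s d c {rs} d∈digits s∈rs rewrite [s+d*c]%p≡[s%p+d*[c%p]]%p s d c with c % p
  ... | zero        = subst (_∈ rs) (sym s%p+d*0%p≡s%p) s∈rs
    where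
    s%p+d*0%p≡s%p : (s % p + d * 0) % p ≡ s % p
    s%p+d*0%p≡s%p = begin
      (s % p + d * 0) % p ≡⟨ cong (λ e → (s % p + e) % p) (ℕP.*-zeroʳ d) ⟩
      (s % p + 0) % p     ≡⟨ cong (_% p) (ℕP.+-identityʳ (s % p)) ⟩
      s % p % p           ≡⟨ m%n%n≡m%n s p ⟩
      s % p               ∎
  ... | c%p@(suc _) = ∈-concatMap⁺ _ (Any.map (λ { refl → ∈-map⁺ (λ e → (s % p + e * c%p) % p) d∈digits }) s∈rs)

  digitCombination%p∈residues : ∀ c m w → digitCombination c m w % p ∈ residues c m
  digitCombination%p∈residues c zero    w = here refl
  digitCombination%p∈residues c (suc m) w =
    ∈-extend _ _ (c m) (digit∈digits (w (fromℕ m))) (digitCombination%p∈residues c m (w ∘ inject₁))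

  combination≢-if-residue-missing : ∀ c m t → (t + coefficientSum c m) % p ∉ residues c m →
                                    ∀ w → combination c m w ≢ + t
  combination≢-if-residue-missing c m t missing w hit =
    missing (subst (λ s → s % p ∈ residues c m) D≡t+S (digitCombination%p∈residues c m w))
    where
    D≡t+S : digitCombination c m w ≡ t + coefficientSum c m
    D≡t+S = ℤP.+-injective (begin
      + digitCombination c m w                 ≡⟨ digitCombination≡combination+coefficientSum c m w ⟩
      combination c m w ℤ.+ + coefficientSum c m ≡⟨ cong (ℤ._+ + coefficientSum c m) hit ⟩
      + t ℤ.+ + coefficientSum c m             ≡⟨ ℤP.pos-+ t (coefficientSum c m) ⟨
      + (t + coefficientSum c m)               ∎)

/-+-/-≃ : ∀ a b c L n .{{_ : NonZero L}} .{{_ : NonZero n}} → c * n ≡ L →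
          a ℚᵘ./ L ℚᵘ.+ b ℚᵘ./ n ≃ᵘ (a ℤ.+ b ℤ.* + c) ℚᵘ./ L
/-+-/-≃ a b c L@(suc _) n@(suc _) c*n≡L = *≡* (begin
  (a ℤ.* + n ℤ.+ b ℤ.* + L) ℤ.* + L                         ≡⟨ cong (λ e → (a ℤ.* + n ℤ.+ b ℤ.* e) ℤ.* e) c*n≡Lℤ ⟨
  (a ℤ.* + n ℤ.+ b ℤ.* (+ c ℤ.* + n)) ℤ.* (+ c ℤ.* + n)    ≡⟨ factor a b (+ c) (+ n) ⟩
  (a ℤ.+ b ℤ.* + c) ℤ.* ((+ c ℤ.* + n) ℤ.* + n)             ≡⟨ cong (λ e → (a ℤ.+ b ℤ.* + c) ℤ.* (e ℤ.* + n)) c*n≡Lℤ ⟩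
  (a ℤ.+ b ℤ.* + c) ℤ.* (+ L ℤ.* + n)                        ≡⟨ cong ((a ℤ.+ b ℤ.* + c) ℤ.*_) (ℤP.pos-* L n) ⟨
  (a ℤ.+ b ℤ.* + c) ℤ.* + (L * n)                            ∎)
  where
  open ≡-Reasoning
  c*n≡Lℤ : + c ℤ.* + n ≡ + L
  c*n≡Lℤ = trans (sym (ℤP.pos-* c n)) (cong +_ c*n≡L)
  factor : ∀ a b c n → (a ℤ.* n ℤ.+ b ℤ.* (c ℤ.* n)) ℤ.* (c ℤ.* n) ≡ (a ℤ.+ b ℤ.* c) ℤ.* ((c ℤ.* n) ℤ.* n)
  factor = solve-∀

/≃1/⇔ : ∀ a L N .{{_ : NonZero L}} .{{_ : NonZero N}} → N ∣ L →
        (a ℚᵘ./ L ≃ᵘ 1ℤ ℚᵘ./ N) ⇔ (a ≡ + (L / N))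
/≃1/⇔ a L@(suc _) N@(suc _) N∣L = mk⇔
  (λ { (*≡* a*N≡1*L) → ℤP.*-cancelʳ-≡ a (+ (L / N)) (+ N) (trans a*N≡1*L (trans (ℤP.*-identityˡ (+ L)) L≡[L/N]*N)) })
  (λ { refl → *≡* (trans (sym L≡[L/N]*N) (sym (ℤP.*-identityˡ (+ L)))) })
  where
  L≡[L/N]*N : + L ≡ + (L / N) ℤ.* + N
  L≡[L/N]*N = trans (cong +_ (sym (m/n*n≡m N∣L))) (ℤP.pos-* (L / N) N)

quotients : ℕ → ℕ → ℕ
quotients L i = L / suc i

wsum≃combination/L : ∀ L .{{_ : NonZero L}} m w → (∀ {k} → k < m → suc k ∣ L) →
                     toℚᵘ (wsum m w) ≃ᵘ combination (quotients L) m w ℚᵘ./ L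
wsum≃combination/L L@(suc _) zero    w _     = *≡* refl
wsum≃combination/L L       (suc m) w 1…m∣L = begin
  toℚᵘ (wsum m (w ∘ inject₁) ℚ.+ x ℚ./ suc m)                 ≈⟨ ℚP.toℚᵘ-homo-+ (wsum m (w ∘ inject₁)) (x ℚ./ suc m) ⟩
  toℚᵘ (wsum m (w ∘ inject₁)) ℚᵘ.+ toℚᵘ (x ℚ./ suc m)         ≈⟨ ℚᵘP.+-cong IH (ℚP.toℚᵘ-fromℚᵘ (x ℚᵘ./ suc m)) ⟩
  combination (quotients L) m (w ∘ inject₁) ℚᵘ./ L ℚᵘ.+ x ℚᵘ./ suc m
    ≈⟨ /-+-/-≃ _ x (L / suc m) L (suc m) (m/n*n≡m (1…m∣L (ℕP.n<1+n m))) ⟩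
  combination (quotients L) (suc m) w ℚᵘ./ L                   ∎
  where
  open ℚᵘP.≃-Reasoning
  x : ℤ
  x = wval (w (fromℕ m))
  IH : toℚᵘ (wsum m (w ∘ inject₁)) ≃ᵘ combination (quotients L) m (w ∘ inject₁) ℚᵘ./ L
  IH = wsum≃combination/L L m (w ∘ inject₁) (1…m∣L ∘ ℕP.m<n⇒m<1+n)

wsum≡1/N⇔ : ∀ L .{{_ : NonZero L}} m w → (∀ {k} → k ≤ m → suc k ∣ L) →
            (wsum m w ≡ 1ℤ ℚ./ suc m) ⇔ (combination (quotients L) m w ≡ + (L / suc m))
wsum≡1/N⇔ L m w 1…N∣L = mk⇔
  (λ wsum≡1/N → Equivalence.to /≃1/N⇔
    (ℚᵘP.≃-trans (ℚᵘP.≃-sym wsum≃) (ℚᵘP.≃-trans (ℚP.toℚᵘ-cong wsum≡1/N) (ℚP.toℚᵘ-fromℚᵘ _))))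
  (λ combination≡L/N → ℚP.toℚᵘ-injective
    (ℚᵘP.≃-trans wsum≃ (ℚᵘP.≃-trans (Equivalence.from /≃1/N⇔ combination≡L/N) (ℚᵘP.≃-sym (ℚP.toℚᵘ-fromℚᵘ _)))))
  where
  wsum≃ : toℚᵘ (wsum m w) ≃ᵘ combination (quotients L) m w ℚᵘ./ L
  wsum≃ = wsum≃combination/L L m w (1…N∣L ∘ ℕP.<⇒≤)
  /≃1/N⇔ : (combination (quotients L) m w ℚᵘ./ L ≃ᵘ 1ℤ ℚᵘ./ suc m) ⇔ (combination (quotients L) m w ≡ + (L / suc m))
  /≃1/N⇔ = /≃1/⇔ (combination (quotients L) m w) L (suc m) (1…N∣L ℕP.≤-refl)

lcmUpTo : ℕ → ℕ
lcmUpTo zero    = 1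
lcmUpTo (suc n) = lcm (suc n) (lcmUpTo n)

lcmUpTo-nonZero : ∀ n → NonZero (lcmUpTo n)
lcmUpTo-nonZero zero    = _
lcmUpTo-nonZero (suc n) = ≢-nonZero lcm≢0
  where
  open ≡-Reasoning
  instance
    lcmUpTo-n≢0 : NonZero (lcmUpTo n)
    lcmUpTo-n≢0 = lcmUpTo-nonZero n
  g : ℕ
  g = gcd (suc n) (lcmUpTo n)
  lcm≢0 : lcm (suc n) (lcmUpTo n) ≢ 0
  lcm≢0 lcm≡0 = ≢-nonZero⁻¹ (suc n * lcmUpTo n) {{ℕP.m*n≢0 (suc n) (lcmUpTo n)}} (begin
    suc n * lcmUpTo n           ≡⟨ gcd*lcm (suc n) (lcmUpTo n) ⟨
    g * lcm (suc n) (lcmUpTo n) ≡⟨ cong (g *_) lcm≡0 ⟩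
    g * 0                       ≡⟨ ℕP.*-zeroʳ g ⟩
    0                           ∎)

∣lcmUpTo : ∀ n {k} → k < n → suc k ∣ lcmUpTo n
∣lcmUpTo (suc n) k<1+n with ℕP.m<1+n⇒m<n∨m≡n k<1+n
... | inj₁ k<n  = ∣-trans (∣lcmUpTo n k<n) (n∣lcm[m,n] (suc n) (lcmUpTo n))
... | inj₂ refl = m∣lcm[m,n] (suc n) (lcmUpTo n)

InU⇔combination≢L/N : ∀ m → InU (suc m) ⇔
  (∀ w → combination (quotients (lcmUpTo (suc m))) m w ≢ + (lcmUpTo (suc m) / suc m))
InU⇔combination≢L/N m =
  mk⇔ (λ N∈U w → N∈U w ∘ Equivalence.from (cleared w)) (λ never w → never w ∘ Equivalence.to (cleared w))
  where
  L : ℕ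
  L = lcmUpTo (suc m)
  instance
    L≢0 : NonZero L
    L≢0 = lcmUpTo-nonZero (suc m)
  cleared : ∀ w → (wsum m w ≡ 1ℤ ℚ./ suc m) ⇔ (combination (quotients L) m w ≡ + (L / suc m))
  cleared w = wsum≡1/N⇔ L m w (∣lcmUpTo (suc m) ∘ s≤s)

signs : List ℕ → List ℕ → (m : ℕ) → Fin m → Weight
signs positive negative m i with suc (toℕ i) ∈? positive | suc (toℕ i) ∈? negative
... | yes _ | _     = plus
... | no _  | yes _ = minus
... | no _  | no _  = zero′

data Certificate : Set where
  residue  : (p : ℕ) .{{_ : NonZero p}} → Certificate
  solution : (positive negative : List ℕ) → Certificate

Valid : List ℕ → ℕ → Certificate → Set
Valid xs m (residue p)        = (L / suc m + coefficientSum c m) % p ∉ residues p c m × suc m ∈ xs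
  where L = lcmUpTo (suc m); c = quotients L
Valid xs m (solution pos neg) = combination c m (signs pos neg m) ≡ + (L / suc m) × suc m ∉ xs
  where L = lcmUpTo (suc m); c = quotients L

valid? : ∀ xs m c → Dec (Valid xs m c)
valid? xs m (residue p)        = ¬? (_ ∈? _) ×-dec (suc m ∈? xs)
valid? xs m (solution pos neg) = (_ ℤ.≟ _) ×-dec ¬? (suc m ∈? xs)

certify : ∀ xs m c → Valid xs m c → InU (suc m) ⇔ suc m ∈ xs
certify xs m (residue p)        (missing , N∈xs) =
  mk⇔ (const N∈xs) (const (Equivalence.from (InU⇔combination≢L/N m)
                             (combination≢-if-residue-missing p _ m _ missing)))
certify xs m (solution pos neg) (hit , N∉xs) =
  mk⇔ (λ N∈U → ⊥-elim (Equivalence.to (InU⇔combination≢L/N m) N∈U _ hit)) (⊥-elim ∘ N∉xs)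

U100 : List ℕ
U100 = 1 ∷ 2 ∷ 3 ∷ 4 ∷ 5 ∷ 7 ∷ 8 ∷ 9 ∷ 10 ∷ 11 ∷ 13 ∷ 14 ∷ 16 ∷ 17 ∷ 19 ∷ 22 ∷ 23 ∷ 25 ∷ 26 ∷ 27 ∷ 29 ∷ 31 ∷ 32 ∷ 34 ∷ 37 ∷ 38 ∷ 39 ∷ 41 ∷ 43 ∷ 46 ∷ 47 ∷ 49 ∷ 50 ∷ 51 ∷ 53 ∷ 57 ∷ 58 ∷ 59 ∷ 61 ∷ 62 ∷ 64 ∷ 67 ∷ 69 ∷ 71 ∷ 73 ∷ 74 ∷ 79 ∷ 81 ∷ 82 ∷ 83 ∷ 86 ∷ 87 ∷ 89 ∷ 92 ∷ 93 ∷ 94 ∷ 97 ∷ 98 ∷ []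

-- Entry i certifies N = i + 1.
certificates : Vec Certificate 100
certificates =
  residue 2 ∷
  residue 2 ∷
  residue 3 ∷
  residue 2 ∷
  residue 5 ∷
  solution (1 ∷ []) (2 ∷ 3 ∷ []) ∷
  residue 7 ∷
  residue 2 ∷
  residue 3 ∷
  residue 5 ∷
  residue 11 ∷
  solution (2 ∷ []) (4 ∷ 6 ∷ []) ∷
  residue 13 ∷
  residue 7 ∷
  solution (6 ∷ 10 ∷ []) (5 ∷ []) ∷
  residue 2 ∷
  residue 17 ∷
  solution (3 ∷ []) (6 ∷ 9 ∷ []) ∷
  residue 19 ∷
  solution (4 ∷ []) (5 ∷ []) ∷
  solution (6 ∷ 7 ∷ 14 ∷ []) (3 ∷ []) ∷
  residue 11 ∷
  residue 23 ∷
  solution (4 ∷ []) (8 ∷ 12 ∷ []) ∷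
  residue 5 ∷
  residue 13 ∷
  residue 3 ∷
  solution (4 ∷ []) (7 ∷ 14 ∷ []) ∷
  residue 29 ∷
  solution (5 ∷ []) (10 ∷ 15 ∷ []) ∷
  residue 31 ∷
  residue 2 ∷
  solution (6 ∷ []) (11 ∷ 22 ∷ []) ∷
  residue 17 ∷
  solution (10 ∷ 14 ∷ []) (7 ∷ []) ∷
  solution (6 ∷ []) (12 ∷ 18 ∷ []) ∷
  residue 37 ∷
  residue 19 ∷
  residue 13 ∷
  solution (5 ∷ []) (8 ∷ 20 ∷ []) ∷
  residue 41 ∷
  solution (7 ∷ []) (14 ∷ 21 ∷ []) ∷
  residue 43 ∷
  solution (12 ∷ 33 ∷ []) (11 ∷ []) ∷
  solution (5 ∷ []) (9 ∷ 15 ∷ []) ∷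
  residue 23 ∷
  residue 47 ∷
  solution (8 ∷ []) (16 ∷ 24 ∷ []) ∷
  residue 7 ∷
  residue 5 ∷
  residue 17 ∷
  solution (12 ∷ []) (26 ∷ 39 ∷ []) ∷
  residue 53 ∷
  solution (9 ∷ []) (18 ∷ 27 ∷ []) ∷
  solution (30 ∷ 33 ∷ []) (22 ∷ []) ∷
  solution (8 ∷ []) (14 ∷ 28 ∷ []) ∷
  residue 19 ∷
  residue 29 ∷
  residue 59 ∷
  solution (20 ∷ []) (30 ∷ []) ∷
  residue 61 ∷
  residue 31 ∷
  solution (9 ∷ 21 ∷ []) (7 ∷ []) ∷
  residue 2 ∷
  solution (10 ∷ 13 ∷ 26 ∷ []) (5 ∷ []) ∷
  solution (11 ∷ []) (22 ∷ 33 ∷ []) ∷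
  residue 67 ∷
  solution (12 ∷ 51 ∷ []) (17 ∷ 34 ∷ []) ∷
  residue 23 ∷
  solution (7 ∷ []) (10 ∷ 35 ∷ []) ∷
  residue 71 ∷
  solution (12 ∷ []) (24 ∷ 36 ∷ []) ∷
  residue 73 ∷
  residue 37 ∷
  solution (3 ∷ 50 ∷ []) (5 ∷ 15 ∷ 25 ∷ 30 ∷ []) ∷
  solution (12 ∷ []) (19 ∷ 57 ∷ []) ∷
  solution (7 ∷ []) (11 ∷ 42 ∷ 66 ∷ []) ∷
  solution (13 ∷ []) (26 ∷ 39 ∷ []) ∷
  residue 79 ∷
  solution (10 ∷ []) (16 ∷ 40 ∷ []) ∷
  residue 3 ∷
  residue 41 ∷
  residue 83 ∷
  solution (14 ∷ []) (28 ∷ 42 ∷ []) ∷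
  solution (10 ∷ []) (17 ∷ 34 ∷ []) ∷
  residue 43 ∷
  residue 29 ∷
  solution (8 ∷ []) (11 ∷ 44 ∷ []) ∷
  residue 89 ∷
  solution (15 ∷ []) (30 ∷ 45 ∷ []) ∷
  solution (42 ∷ []) (78 ∷ []) ∷
  residue 23 ∷
  residue 31 ∷
  residue 47 ∷
  solution (38 ∷ 57 ∷ []) (30 ∷ []) ∷
  solution (16 ∷ []) (32 ∷ 48 ∷ []) ∷
  residue 97 ∷
  residue 7 ∷
  solution (11 ∷ 33 ∷ []) (9 ∷ []) ∷
  solution (20 ∷ []) (25 ∷ []) ∷
  []

certified : (i : Fin 100) → Valid U100 (toℕ i) (lookup certificates i)
certified = toWitness {a? = all? (λ i → valid? U100 (toℕ i) (lookup certificates i))} _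

lemma5 : ∀ (N : ℕ) → N ≤ 100 →
    (InU N ⇔ N ∈ (1 ∷ 2 ∷ 3 ∷ 4 ∷ 5 ∷ 7 ∷ 8 ∷ 9 ∷ 10 ∷ 11 ∷ 13 ∷ 14 ∷ 16 ∷ 17 ∷ 19 ∷ 22 ∷ 23 ∷ 25 ∷ 26 ∷ 27 ∷ 29 ∷ 31 ∷ 32 ∷ 34 ∷ 37 ∷ 38 ∷ 39 ∷ 41 ∷ 43 ∷ 46 ∷ 47 ∷ 49 ∷ 50 ∷ 51 ∷ 53 ∷ 57 ∷ 58 ∷ 59 ∷ 61 ∷ 62 ∷ 64 ∷ 67 ∷ 69 ∷ 71 ∷ 73 ∷ 74 ∷ 79 ∷ 81 ∷ 82 ∷ 83 ∷ 86 ∷ 87 ∷ 89 ∷ 92 ∷ 93 ∷ 94 ∷ 97 ∷ 98 ∷ []))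
lemma5 zero    _       = mk⇔ (λ ()) (toWitnessFalse {a? = 0 ∈? U100} _)
lemma5 (suc m) 1+m≤100 =
  subst (λ n → InU (suc n) ⇔ suc n ∈ U100) (toℕ-fromℕ< 1+m≤100) (certify U100 _ _ (certified (fromℕ< 1+m≤100)))
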